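{- Let $T$ be a caterpillar. Then $P_b(T) = \mathrm{diam}(T)$.
   Context: All graphs are finite, simple, undirected and connected with at least two vertices. For a graph $G$, $d(u,v)$ is the distance, $\mathrm{ecc}(v)$ the eccentricity, $\mathrm{diam}(G)$ the diameter. A broadcast on $G$ is a function $f: V(G) \to \{0,\dots,\mathrm{diam}(G)\}$ with $f(v) \leq \mathrm{ecc}(v)$; its weight is $\sum_v f(v)$. A vertex $u$ hears a broadcasting vertex $v$ ($f(v)>0$) if $d(u,v) \leq f(v)$. A packing broadcast is one in which every vertex hears at most one broadcasting vertex; $P_b(G)$ is the maximum weight of a packing broadcast. A caterpillar is a tree in which deleting all leaves leaves a path. -}

module Defs where

open import Data.Nat using (ℕ; zero; suc; _+_; _≤_; _<_)
open import Data.Fin using (Fin; zero; suc; toℕ; inject₁; fromℕ)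
open import Data.List using (List; map; allFin)
open import Data.Nat.ListAction using (sum)
open import Data.Product using (Σ; ∃; ∃-syntax; _×_; _,_)
open import Data.Sum using (_⊎_)
open import Relation.Binary.PropositionalEquality using (_≡_)
open import Relation.Nullary using (¬_)
open import Function.Definitions using (Injective)
open import Function.Bundles using (_⇔_)

record Graph (n : ℕ) : Set₁ where
  field
    Adj    : Fin n → Fin n → Set
    sym    : ∀ {u v} → Adj u v → Adj v u
    irrefl : ∀ {u} → ¬ Adj u u
open Graph public

module _ {n : ℕ} (G : Graph n) where

  data Walk : Fin n → Fin n → ℕ → Set where
    here : ∀ {u} → Walk u u 0
    step : ∀ {u v w k} → Adj G u v → Walk v w k → Walk u w (suc k)

  Connected : Set
  Connected = ∀ u v → ∃[ k ] Walk u v k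

  Within : Fin n → Fin n → ℕ → Set
  Within u v k = ∃[ j ] (j ≤ k × Walk u v j)

  Dist : Fin n → Fin n → ℕ → Set
  Dist u v k = Walk u v k × (∀ j → Walk u v j → k ≤ j)

  Ecc : Fin n → ℕ → Set
  Ecc v e = (∀ u → Within v u e) × (∃[ u ] Dist v u e)

  Diam : ℕ → Set
  Diam D = (∀ u v → Within u v D) × (∃[ u ] ∃[ v ] Dist u v D)

  -- a cycle: distinct vertices c 0, …, c (m+2), consecutive ones adjacent,
  -- and the last adjacent to the first (length ≥ 3)
  record Cycle : Set where
    field
      m     : ℕ
      c     : Fin (suc (suc (suc m))) → Fin n
      inj   : Injective _≡_ _≡_ c
      adj   : ∀ (i : Fin (suc (suc m))) → Adj G (c (inject₁ i)) (c (suc i))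
      close : Adj G (c (fromℕ (suc (suc m)))) (c zero)

  Acyclic : Set
  Acyclic = ¬ Cycle

  Tree : Set
  Tree = Connected × Acyclic

  Leaf : Fin n → Set
  Leaf v = ∃[ u ] (Adj G v u × (∀ w → Adj G v w → w ≡ u))

  -- deleting all leaves leaves a path: the non-leaf vertices can be listed
  -- without repetition as p 0, …, p (m-1), and two of them are adjacent
  -- iff they are consecutive in this listing (induced subgraph is a path;
  -- m = 0 allowed, e.g. for K₂).
  Caterpillar : Set
  Caterpillar = Tree × ∃[ m ] Σ (Fin m → Fin n) λ p →
      Injective _≡_ _≡_ p
    × (∀ v → (¬ Leaf v) ⇔ (∃[ i ] p i ≡ v))
    × (∀ i j → Adj G (p i) (p j) ⇔ (suc (toℕ i) ≡ toℕ j ⊎ suc (toℕ j) ≡ toℕ i))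

  Broadcast : (Fin n → ℕ) → Set
  Broadcast f = ∀ v e → Ecc v e → f v ≤ e

  Hears : (Fin n → ℕ) → Fin n → Fin n → Set
  Hears f u v = 0 < f v × Within v u (f v)

  Packing : (Fin n → ℕ) → Set
  Packing f = Broadcast f × (∀ u v w → Hears f u v → Hears f u w → v ≡ w)

  weight : (Fin n → ℕ) → ℕ
  weight f = sum (map f (allFin n))

  PackingBroadcastNumber : ℕ → Set
  PackingBroadcastNumber p =
    (∃[ f ] (Packing f × weight f ≡ p)) × (∀ f → Packing f → weight f ≤ p)

module Submission where

-- A vertex broadcasting with power D from one end of a diametral path reaches everything and
-- is the only broadcaster, so P_b ≥ diam.  Conversely, prolong the spine of the caterpillar by
-- a leaf at each end to a path y 0, …, y L with L ≤ diam; every other vertex is a leaf hanging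
-- from an interior y i, and projecting onto the path is non-expanding.  Weight position j by
-- its degree in the path, for a total of 2L.  The eccentricity of any vertex is attained at an
-- end of the path, so a vertex broadcasting with power k > 0 has room on one side to be heard
-- by a window of k + 1 consecutive positions, of weight at least 2k (a pendant leaf with k = 1
-- is heard by the interior vertex below it, of weight 2).  Since every y j hears at most one
-- broadcaster, twice the weight of a packing broadcast is at most 2L.

open import Defs renaming (sym to Adj-sym)
open import Data.Nat using (ℕ; zero; suc; _+_; _∸_; _≤_; _<_; z≤n; s≤s; _≤?_; _<?_; ∣_-_∣)
open import Data.Nat.Properties hiding (_≟_)
open import Data.Nat.Properties using () renaming (_≟_ to _≟ℕ_)
open import Data.Nat.ListAction using (sum)
open import Data.Nat.Tactic.RingSolver using (solve-∀)
open import Data.Fin using (Fin; zero; suc; toℕ; fromℕ; fromℕ<; inject₁; _≟_)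
open import Data.Fin.Properties using (any?; toℕ-injective; toℕ-fromℕ<; fromℕ<-toℕ; toℕ-fromℕ; toℕ-inject₁; toℕ<n)
  renaming (suc-injective to Fin-suc-injective; 0≢1+n to zero≢suc)
open import Data.List using (tabulate)
open import Data.List.Properties using (map-tabulate)
open import Data.Product using (∃-syntax; _×_; _,_; proj₁; proj₂)
open import Data.Sum using (_⊎_; inj₁; inj₂)
open import Data.Empty using (⊥-elim)
open import Relation.Binary.PropositionalEquality
open import Relation.Nullary using (¬_; Dec; yes; no)
open import Relation.Nullary.Decidable using (_×-dec_; _⊎-dec_; map′; ¬?; decidable-stable)
open import Function using (_∘_; id)
open import Function.Bundles using (_⇔_; Equivalence)
open import Function.Definitions using (Injective)
open import Algebra.Properties.CommutativeSemigroup +-commutativeSemigroup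
  using (interchange; xy∙z≈xz∙y; xy∙z≈y∙zx)

∑ : ∀ {n} → (Fin n → ℕ) → ℕ
∑ {zero}  g = 0
∑ {suc n} g = g zero + ∑ (g ∘ suc)

weight≡∑ : ∀ {n} (G : Graph n) (f : Fin n → ℕ) → weight G f ≡ ∑ f
weight≡∑ G f = trans (cong sum (map-tabulate id f)) (sum-tabulate f)
  where
  sum-tabulate : ∀ {m} (g : Fin m → ℕ) → sum (tabulate g) ≡ ∑ g
  sum-tabulate {zero}  g = refl
  sum-tabulate {suc m} g = cong (g zero +_) (sum-tabulate (g ∘ suc))

∑-mono-≤ : ∀ {n} {g h : Fin n → ℕ} → (∀ x → g x ≤ h x) → ∑ g ≤ ∑ h
∑-mono-≤ {zero}  g≤h = z≤n
∑-mono-≤ {suc n} g≤h = +-mono-≤ (g≤h zero) (∑-mono-≤ (g≤h ∘ suc))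

∑-distrib-+ : ∀ {n} (g h : Fin n → ℕ) → ∑ (λ x → g x + h x) ≡ ∑ g + ∑ h
∑-distrib-+ {zero}  g h = refl
∑-distrib-+ {suc n} g h =
  trans (cong (g zero + h zero +_) (∑-distrib-+ (g ∘ suc) (h ∘ suc))) (interchange (g zero) (h zero) _ _)

∑-zero : ∀ {n} {g : Fin n → ℕ} → (∀ x → g x ≡ 0) → ∑ g ≡ 0
∑-zero {zero}  g≡0 = refl
∑-zero {suc n} g≡0 = cong₂ _+_ (g≡0 zero) (∑-zero (g≡0 ∘ suc))

≤-∑ : ∀ {n} (g : Fin n → ℕ) x → g x ≤ ∑ g
≤-∑ g zero    = m≤m+n _ _
≤-∑ g (suc x) = ≤-trans (≤-∑ (g ∘ suc) x) (m≤n+m _ _)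

∑-≤-unique-support : ∀ {n} {g : Fin n → ℕ} {B} → (∀ x y → 0 < g x → 0 < g y → x ≡ y) →
                     (∀ x → g x ≤ B) → ∑ g ≤ B
∑-≤-unique-support {zero} unique g≤B = z≤n
∑-≤-unique-support {suc n} {g} {B} unique g≤B with 0 <? g zero
... | yes 0<g0 = subst (_≤ B) (sym (trans (cong (g zero +_) (∑-zero rest≡0)) (+-identityʳ _))) (g≤B zero)
  where
  rest≡0 : ∀ x → g (suc x) ≡ 0
  rest≡0 x = n≤0⇒n≡0 (≮⇒≥ λ 0<gx → zero≢suc (unique zero (suc x) 0<g0 0<gx))
... | no 0≮g0 rewrite n≤0⇒n≡0 (≮⇒≥ 0≮g0) =
  ∑-≤-unique-support (λ x y 0<gx 0<gy → Fin-suc-injective (unique _ _ 0<gx 0<gy)) (g≤B ∘ suc)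

∑⟨_,_⟩ : ℕ → ℕ → (ℕ → ℕ) → ℕ
∑⟨ a , zero  ⟩ g = 0
∑⟨ a , suc l ⟩ g = g a + ∑⟨ suc a , l ⟩ g

∑⟨⟩-++ : ∀ g a l l′ → ∑⟨ a , l + l′ ⟩ g ≡ ∑⟨ a , l ⟩ g + ∑⟨ a + l , l′ ⟩ g
∑⟨⟩-++ g a zero    l′ rewrite +-identityʳ a = refl
∑⟨⟩-++ g a (suc l) l′ rewrite ∑⟨⟩-++ g (suc a) l l′ | +-suc a l = sym (+-assoc (g a) _ _)

∑⟨⟩-snoc : ∀ g a l → ∑⟨ a , suc l ⟩ g ≡ ∑⟨ a , l ⟩ g + g (a + l)
∑⟨⟩-snoc g a l = begin
  ∑⟨ a , suc l ⟩ g                    ≡⟨ cong (λ m → ∑⟨ a , m ⟩ g) (+-comm 1 l) ⟩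
  ∑⟨ a , l + 1 ⟩ g                    ≡⟨ ∑⟨⟩-++ g a l 1 ⟩
  ∑⟨ a , l ⟩ g + (g (a + l) + 0)      ≡⟨ cong (∑⟨ a , l ⟩ g +_) (+-identityʳ _) ⟩
  ∑⟨ a , l ⟩ g + g (a + l)            ∎
  where open ≡-Reasoning

∑⟨⟩-mono-≤ : ∀ {g h} a l → (∀ j → a ≤ j → j < a + l → g j ≤ h j) → ∑⟨ a , l ⟩ g ≤ ∑⟨ a , l ⟩ h
∑⟨⟩-mono-≤ a zero    g≤h = z≤n
∑⟨⟩-mono-≤ a (suc l) g≤h =
  +-mono-≤ (g≤h a ≤-refl (m<m+n a (s≤s z≤n)))
           (∑⟨⟩-mono-≤ (suc a) l λ j a<j j<a+l → g≤h j (<⇒≤ a<j) (subst (j <_) (sym (+-suc a l)) j<a+l))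

∑⟨⟩-window-≤ : ∀ g {a l N} → a + l ≤ N → ∑⟨ a , l ⟩ g ≤ ∑⟨ 0 , N ⟩ g
∑⟨⟩-window-≤ g {a} {l} {N} a+l≤N = begin
  ∑⟨ a , l ⟩ g                                       ≤⟨ m≤n+m _ _ ⟩
  ∑⟨ 0 , a ⟩ g + ∑⟨ a , l ⟩ g                         ≡⟨ sym (∑⟨⟩-++ g 0 a l) ⟩
  ∑⟨ 0 , a + l ⟩ g                                   ≤⟨ m≤m+n _ _ ⟩
  ∑⟨ 0 , a + l ⟩ g + ∑⟨ a + l , N ∸ (a + l) ⟩ g       ≡⟨ sym (∑⟨⟩-++ g 0 (a + l) _) ⟩
  ∑⟨ 0 , a + l + (N ∸ (a + l)) ⟩ g                   ≡⟨ cong (λ m → ∑⟨ 0 , m ⟩ g) (m+[n∸m]≡n a+l≤N) ⟩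
  ∑⟨ 0 , N ⟩ g                                       ∎
  where open ≤-Reasoning

∑-∑⟨⟩-swap : ∀ {n} (h : Fin n → ℕ → ℕ) a l →
             ∑ (λ v → ∑⟨ a , l ⟩ (h v)) ≡ ∑⟨ a , l ⟩ (λ j → ∑ (λ v → h v j))
∑-∑⟨⟩-swap {n} h a zero    = ∑-zero {n} λ _ → refl
∑-∑⟨⟩-swap     h a (suc l) = trans (∑-distrib-+ (λ v → h v a) (λ v → ∑⟨ suc a , l ⟩ (h v)))
                                   (cong (∑ (λ v → h v a) +_) (∑-∑⟨⟩-swap h (suc a) l))

m+m≤n+n⇒m≤n : ∀ {m n} → m + m ≤ n + n → m ≤ n
m+m≤n+n⇒m≤n m+m≤n+n = ≮⇒≥ λ n<m → <⇒≱ (+-mono-< n<m n<m) m+m≤n+n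

∣m-n∣≤o : ∀ {m n o} → m ≤ o + n → n ≤ o + m → ∣ m - n ∣ ≤ o
∣m-n∣≤o {m} {n} {o} m≤o+n n≤o+m with ≤-total m n
... | inj₁ m≤n rewrite m≤n⇒∣m-n∣≡n∸m m≤n = m≤n+o⇒m∸n≤o n m (subst (n ≤_) (+-comm o m) n≤o+m)
... | inj₂ n≤m rewrite m≤n⇒∣n-m∣≡n∸m n≤m = m≤n+o⇒m∸n≤o m n (subst (m ≤_) (+-comm o n) m≤o+n)

t+[m∸n]≤k : ∀ {t m n k} → n ≤ m → t + m ≤ k + n → t + (m ∸ n) ≤ k
t+[m∸n]≤k {t} {m} {n} {k} n≤m t+m≤k+n = +-cancelʳ-≤ n (t + (m ∸ n)) k (begin
  t + (m ∸ n) + n  ≡⟨ +-assoc t (m ∸ n) n ⟩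
  t + (m ∸ n + n)  ≡⟨ cong (t +_) (m∸n+n≡m n≤m) ⟩
  t + m            ≤⟨ t+m≤k+n ⟩
  k + n            ∎)
  where open ≤-Reasoning

far-bound : ∀ {t j i M L} → t ≤ j → t + j ≤ L → i ≤ M → L ≤ M + i → ∣ i - j ∣ + t ≤ M
far-bound {t} {j} {i} {M} t≤j t+j≤L i≤M L≤M+i with ≤-total i j
... | inj₁ i≤j rewrite m≤n⇒∣m-n∣≡n∸m i≤j | +-comm (j ∸ i) t = t+[m∸n]≤k i≤j (≤-trans t+j≤L L≤M+i)
... | inj₂ j≤i rewrite m≤n⇒∣n-m∣≡n∸m j≤i =
  ≤-trans (+-monoʳ-≤ (i ∸ j) t≤j) (≤-trans (≤-reflexive (m∸n+n≡m j≤i)) i≤M)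

in-window : ∀ {t i k a j} → a + t ≤ i → t + i ≤ a + k → a ≤ j → j ≤ a + k → t + ∣ i - j ∣ ≤ k
in-window {t} {i} {k} {a} {j} a+t≤i t+i≤a+k a≤j j≤a+k with ≤-total i j
... | inj₁ i≤j rewrite m≤n⇒∣m-n∣≡n∸m i≤j = t+[m∸n]≤k i≤j (begin
  t + j        ≤⟨ +-monoʳ-≤ t j≤a+k ⟩
  t + (a + k)  ≡⟨ sym (+-assoc t a k) ⟩
  t + a + k    ≡⟨ cong (_+ k) (+-comm t a) ⟩
  a + t + k    ≤⟨ +-monoˡ-≤ k a+t≤i ⟩
  i + k        ≡⟨ +-comm i k ⟩
  k + i        ∎)
  where open ≤-Reasoning
... | inj₂ j≤i rewrite m≤n⇒∣n-m∣≡n∸m j≤i =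
  t+[m∸n]≤k j≤i (≤-trans t+i≤a+k (≤-trans (+-monoˡ-≤ k a≤j) (≤-reflexive (+-comm j k))))

-- The window is [t + i ∸ k, t + i] or [i ∸ t, i ∸ t + k], whichever side of i the
-- eccentricity bound leaves room on.
window-exists : ∀ {t i k L} → t + t ≤ k → t ≤ i → t + i ≤ L → (k ≤ t + i) ⊎ (k + i ≤ t + L) →
                ∃[ a ] (a + k ≤ L × a + t ≤ i × t + i ≤ a + k)
window-exists {t} {i} {k} {L} 2t≤k _ t+i≤L (inj₁ k≤t+i) =
  t + i ∸ k , ≤-trans (≤-reflexive a+k≡t+i) t+i≤L , a+t≤i , ≤-reflexive (sym a+k≡t+i)
  where
  a = t + i ∸ k
  a+k≡t+i : a + k ≡ t + i
  a+k≡t+i = m∸n+n≡m k≤t+i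
  a+t≤i : a + t ≤ i
  a+t≤i = +-cancelʳ-≤ k (a + t) i (begin
    a + t + k    ≡⟨ xy∙z≈xz∙y a t k ⟩
    a + k + t    ≡⟨ cong (_+ t) a+k≡t+i ⟩
    t + i + t    ≡⟨ xy∙z≈y∙zx t i t ⟩
    i + (t + t)  ≤⟨ +-monoʳ-≤ i 2t≤k ⟩
    i + k        ∎)
    where open ≤-Reasoning
window-exists {t} {i} {k} {L} 2t≤k t≤i _ (inj₂ k+i≤t+L) =
  i ∸ t , a+k≤L , ≤-reflexive a+t≡i , t+i≤a+k
  where
  open ≤-Reasoning
  a = i ∸ t
  a+t≡i : a + t ≡ i
  a+t≡i = m∸n+n≡m t≤i
  a+k≤L : a + k ≤ L
  a+k≤L = +-cancelʳ-≤ t (a + k) L (begin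
    a + k + t  ≡⟨ xy∙z≈xz∙y a k t ⟩
    a + t + k  ≡⟨ cong (_+ k) a+t≡i ⟩
    i + k      ≡⟨ +-comm i k ⟩
    k + i      ≤⟨ k+i≤t+L ⟩
    t + L      ≡⟨ +-comm t L ⟩
    L + t      ∎)
  t+i≤a+k : t + i ≤ a + k
  t+i≤a+k = +-cancelʳ-≤ t (t + i) (a + k) (begin
    t + i + t    ≡⟨ xy∙z≈y∙zx t i t ⟩
    i + (t + t)  ≤⟨ +-monoʳ-≤ i 2t≤k ⟩
    i + k        ≡⟨ cong (_+ k) (sym a+t≡i) ⟩
    a + t + k    ≡⟨ xy∙z≈xz∙y a t k ⟩
    a + k + t    ∎)

2t≰k⇒t≡1∧k≡1 : ∀ {t k} → t ≤ 1 → 0 < k → ¬ (t + t ≤ k) → t ≡ 1 × k ≡ 1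
2t≰k⇒t≡1∧k≡1 {zero}        _         0<k 2t≰k = ⊥-elim (2t≰k z≤n)
2t≰k⇒t≡1∧k≡1 {suc zero} {suc zero} _ _   _    = refl , refl
2t≰k⇒t≡1∧k≡1 {suc zero} {suc (suc k)} _ _ 2t≰k = ⊥-elim (2t≰k (s≤s (s≤s z≤n)))
2t≰k⇒t≡1∧k≡1 {suc (suc t)} (s≤s ())

suc-double : ∀ m → suc m + suc m ≡ 1 + (m + m + 1)
suc-double = solve-∀

when : ∀ {A : Set} → Dec A → ℕ → ℕ
when (yes _) x = x
when (no _)  _ = 0

when-witness : ∀ {A : Set} (d : Dec A) {x} → 0 < when d x → A
when-witness (yes a) _ = a

when-yes : ∀ {A : Set} (d : Dec A) {x} → A → when d x ≡ x
when-yes (yes _) _ = refl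
when-yes (no ¬a) a = ⊥-elim (¬a a)

when-no : ∀ {A : Set} (d : Dec A) {x} → ¬ A → when d x ≡ 0
when-no (yes a) ¬a = ⊥-elim (¬a a)
when-no (no _)  _  = refl

when-≤ : ∀ {A : Set} (d : Dec A) {x} → when d x ≤ x
when-≤ (yes _) = ≤-refl
when-≤ (no _)  = z≤n

module _ {n : ℕ} (G : Graph n) where

  _++ᵂ_ : ∀ {u v w j k} → Walk G u v j → Walk G v w k → Walk G u w (j + k)
  here     ++ᵂ q = q
  step a p ++ᵂ q = step a (p ++ᵂ q)

  reverseᵂ : ∀ {u v k} → Walk G u v k → Walk G v u k
  reverseᵂ here                 = here
  reverseᵂ {k = suc k} (step a p) =
    subst (Walk G _ _) (+-comm k 1) (reverseᵂ p ++ᵂ step (Adj-sym G a) here)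

  diametral-packing : ∀ {D} → Diam G D → ∃[ f ] (Packing G f × weight G f ≡ D)
  diametral-packing {D} (_ , u , v , _ , minimal) = f , (broadcast , unique) , weight≡D
    where
    f : Fin n → ℕ
    f x = when (x ≟ u) D

    broadcast : Broadcast G f
    broadcast x e (within , _) with x ≟ u
    ... | no  _    = z≤n
    ... | yes refl with within v
    ...   | j , j≤e , walk = ≤-trans (minimal j walk) j≤e

    one-broadcaster : ∀ x y → 0 < f x → 0 < f y → x ≡ y
    one-broadcaster x y 0<fx 0<fy = trans (when-witness (x ≟ u) 0<fx) (sym (when-witness (y ≟ u) 0<fy))

    unique : ∀ w x y → Hears G f w x → Hears G f w y → x ≡ y
    unique _ x y (0<fx , _) (0<fy , _) = one-broadcaster x y 0<fx 0<fy

    weight≡D : weight G f ≡ D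
    weight≡D rewrite weight≡∑ G f = ≤-antisym
      (∑-≤-unique-support one-broadcaster (λ x → when-≤ (x ≟ u)))
      (subst (_≤ ∑ f) (when-yes (u ≟ u) refl) (≤-∑ f u))

  data Attachment (path : ℕ → Fin n) (L : ℕ) (w : Fin n) (i : ℕ) : Set where
    on-path : path i ≡ w → Attachment path L w i
    pendant : Adj G w (path i) → (∀ z → Adj G w z → z ≡ path i) → 1 ≤ i → i < L →
              Attachment path L w i

  record Frame : Set where
    field
      L          : ℕ
      1≤L        : 1 ≤ L
      path       : ℕ → Fin n
      path-adj   : ∀ i → i < L → Adj G (path i) (path (suc i))
      proj       : Fin n → ℕ
      proj≤L     : ∀ w → proj w ≤ L
      proj-path  : ∀ i → i ≤ L → proj (path i) ≡ i
      proj-adj   : ∀ {u v} → Adj G u v → proj u ≤ suc (proj v)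
      attachment : ∀ w → Attachment path L w (proj w)

  module FrameProperties (F : Frame) where
    open Frame F

    height-of : ∀ {w i} → Attachment path L w i → ℕ
    height-of (on-path _)       = 0
    height-of (pendant _ _ _ _) = 1

    height : Fin n → ℕ
    height w = height-of (attachment w)

    height≤1 : ∀ w → height w ≤ 1
    height≤1 w with attachment w
    ... | on-path _       = z≤n
    ... | pendant _ _ _ _ = ≤-refl

    height≤proj : ∀ w → height w ≤ proj w
    height≤proj w with attachment w
    ... | on-path _         = z≤n
    ... | pendant _ _ 1≤i _ = 1≤i

    height+proj≤L : ∀ w → height w + proj w ≤ L
    height+proj≤L w with attachment w
    ... | on-path _         = proj≤L w
    ... | pendant _ _ _ i<L = i<L

    to-path : ∀ w → Walk G w (path (proj w)) (height w)
    to-path w with attachment w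
    ... | on-path path≡w  = subst (λ x → Walk G x (path (proj w)) 0) path≡w here
    ... | pendant adj _ _ _ = step adj here

    proj-walk-≤ : ∀ {u v j} → Walk G u v j → proj u ≤ j + proj v
    proj-walk-≤ here         = ≤-refl
    proj-walk-≤ (step adj p) = ≤-trans (proj-adj adj) (s≤s (proj-walk-≤ p))

    proj-walk : ∀ {u v j} → Walk G u v j → ∣ proj u - proj v ∣ ≤ j
    proj-walk p = ∣m-n∣≤o (proj-walk-≤ p) (proj-walk-≤ (reverseᵂ p))

    path-down : ∀ d i → d + i ≤ L → Walk G (path (d + i)) (path i) d
    path-down zero    i _      = here
    path-down (suc d) i d+i<L = step (Adj-sym G (path-adj (d + i) d+i<L)) (path-down d i (<⇒≤ d+i<L))

    path-down-≤ : ∀ {i j} → i ≤ j → j ≤ L → Walk G (path j) (path i) (j ∸ i)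
    path-down-≤ {i} {j} i≤j j≤L = subst (λ x → Walk G (path x) (path i) (j ∸ i)) (m∸n+n≡m i≤j)
      (path-down (j ∸ i) i (subst (_≤ L) (sym (m∸n+n≡m i≤j)) j≤L))

    path-walk : ∀ {i j} → i ≤ L → j ≤ L → Walk G (path i) (path j) ∣ i - j ∣
    path-walk {i} {j} i≤L j≤L with ≤-total i j
    ... | inj₁ i≤j rewrite m≤n⇒∣m-n∣≡n∸m i≤j = reverseᵂ (path-down-≤ i≤j j≤L)
    ... | inj₂ j≤i rewrite m≤n⇒∣n-m∣≡n∸m j≤i = path-down-≤ j≤i i≤L

    pendant-walk-≥ : ∀ {w k j} → k ≤ L → Adj G w (path (proj w)) → (∀ z → Adj G w z → z ≡ path (proj w)) →
                     Walk G w (path k) j → 1 + ∣ proj w - k ∣ ≤ j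
    pendant-walk-≥ {k = k} k≤L adj _ here =
      ⊥-elim (irrefl G (subst (λ i → Adj G (path k) (path i)) (proj-path k k≤L) adj))
    pendant-walk-≥ {w} {k} k≤L _ unique (step {v = x} adj p) = s≤s (subst₂ (λ a b → ∣ a - b ∣ ≤ _)
      (trans (cong proj (unique x adj)) (proj-path (proj w) (proj≤L w))) (proj-path k k≤L) (proj-walk p))

    walk-to-path-≥ : ∀ w {k j} → k ≤ L → Walk G w (path k) j → height w + ∣ proj w - k ∣ ≤ j
    walk-to-path-≥ w {k} k≤L p with attachment w
    ... | on-path _               = subst (λ x → ∣ proj w - x ∣ ≤ _) (proj-path k k≤L) (proj-walk p)
    ... | pendant adj unique _ _ = pendant-walk-≥ k≤L adj unique p

    walk-via-path : ∀ w z → Walk G w z (height w + (∣ proj w - proj z ∣ + height z))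
    walk-via-path w z = to-path w ++ᵂ (path-walk (proj≤L w) (proj≤L z) ++ᵂ reverseᵂ (to-path z))

    reach : Fin n → ℕ → ℕ
    reach w j = height w + ∣ proj w - j ∣

    walk-reach : ∀ w {j} → j ≤ L → Walk G w (path j) (reach w j)
    walk-reach w j≤L = to-path w ++ᵂ path-walk (proj≤L w) j≤L

    ecc-via-end : ∀ w {e M} → e ≤ L → ∣ proj w - e ∣ ≡ M → proj w ≤ M → L ≤ M + proj w →
                  Ecc G w (height w + M)
    ecc-via-end w {e} {M} e≤L dist≡M i≤M L≤M+i = covers , path e , walk , minimal
      where
      covers : ∀ z → Within G w z (height w + M)
      covers z = _ , +-monoʳ-≤ (height w) (far-bound (height≤proj z) (height+proj≤L z) i≤M L≤M+i)
                   , walk-via-path w z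
      walk : Walk G w (path e) (height w + M)
      walk = subst (λ d → Walk G w (path e) (height w + d)) dist≡M (walk-reach w e≤L)
      minimal : ∀ j → Walk G w (path e) j → height w + M ≤ j
      minimal j p = subst (λ d → height w + d ≤ j) dist≡M (walk-to-path-≥ w e≤L p)

    broadcast-bound : ∀ {f} → Broadcast G f → ∀ w →
                      (f w ≤ height w + proj w) ⊎ (f w + proj w ≤ height w + L)
    broadcast-bound {f} bf w with L ≤? proj w + proj w
    ... | yes L≤2i = inj₁ (bf w _ (ecc-via-end w z≤n (∣-∣-identityʳ (proj w)) ≤-refl L≤2i))
    ... | no  L≰2i = inj₂ (begin
      f w + i                 ≤⟨ +-monoˡ-≤ i (bf w _ ecc-right) ⟩
      height w + (L ∸ i) + i  ≡⟨ +-assoc (height w) (L ∸ i) i ⟩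
      height w + (L ∸ i + i)  ≡⟨ cong (height w +_) L∸i+i≡L ⟩
      height w + L            ∎)
      where
      open ≤-Reasoning
      i = proj w
      L∸i+i≡L : L ∸ i + i ≡ L
      L∸i+i≡L = m∸n+n≡m (proj≤L w)
      ecc-right : Ecc G w (height w + (L ∸ i))
      ecc-right = ecc-via-end w ≤-refl (m≤n⇒∣m-n∣≡n∸m (proj≤L w))
                    (m+n≤o⇒m≤o∸n i (<⇒≤ (≰⇒> L≰2i))) (≤-reflexive (sym L∸i+i≡L))

    path-degree : ℕ → ℕ
    path-degree zero    = 1
    path-degree (suc j) = 1 + when (suc j <? L) 1

    1≤path-degree : ∀ j → 1 ≤ path-degree j
    1≤path-degree zero    = ≤-refl
    1≤path-degree (suc j) = s≤s z≤n

    path-degree-interior : ∀ {j} → 1 ≤ j → j < L → path-degree j ≡ 2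
    path-degree-interior {suc j} _ j<L = cong suc (when-yes (suc j <? L) j<L)

    path-degree-end : ∀ {j} → 1 ≤ j → ¬ (j < L) → path-degree j ≡ 1
    path-degree-end {suc j} _ j≮L = cong suc (when-no (suc j <? L) j≮L)

    ∑-path-degree-interior : ∀ a l → 1 ≤ a → a + l ≤ L → ∑⟨ a , l ⟩ path-degree ≡ l + l
    ∑-path-degree-interior a zero    _   _     = refl
    ∑-path-degree-interior a (suc l) 1≤a a+l≤L = begin
      path-degree a + ∑⟨ suc a , l ⟩ path-degree ≡⟨ cong₂ _+_ (path-degree-interior 1≤a a<L)
                                                      (∑-path-degree-interior (suc a) l (s≤s z≤n) 1+a+l≤L) ⟩
      2 + (l + l)                               ≡⟨ cong suc (sym (+-suc l l)) ⟩
      suc l + suc l                             ∎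
      where
      open ≡-Reasoning
      1+a+l≤L : suc a + l ≤ L
      1+a+l≤L = subst (_≤ L) (+-suc a l) a+l≤L
      a<L : a < L
      a<L = <-≤-trans (s≤s (m≤m+n a l)) 1+a+l≤L

    ∑-path-degree : ∑⟨ 0 , suc L ⟩ path-degree ≡ L + L
    ∑-path-degree = begin
      1 + ∑⟨ 1 , L ⟩ path-degree                   ≡⟨ cong (λ m → 1 + ∑⟨ 1 , m ⟩ path-degree) (sym 1+l≡L) ⟩
      1 + ∑⟨ 1 , suc l ⟩ path-degree               ≡⟨ cong (1 +_) (∑⟨⟩-snoc path-degree 1 l) ⟩
      1 + (∑⟨ 1 , l ⟩ path-degree + path-degree (suc l))
        ≡⟨ cong (λ m → 1 + (m + _)) (∑-path-degree-interior 1 l ≤-refl (≤-reflexive 1+l≡L)) ⟩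
      1 + (l + l + path-degree (suc l))            ≡⟨ cong (λ m → 1 + (l + l + m)) path-degree-last ⟩
      1 + (l + l + 1)                              ≡⟨ sym (suc-double l) ⟩
      suc l + suc l                                ≡⟨ cong₂ _+_ 1+l≡L 1+l≡L ⟩
      L + L                                        ∎
      where
      open ≡-Reasoning
      l = L ∸ 1
      1+l≡L : suc l ≡ L
      1+l≡L = m+[n∸m]≡n 1≤L
      path-degree-last : path-degree (suc l) ≡ 1
      path-degree-last = path-degree-end (s≤s z≤n) (subst (λ m → ¬ m < L) (sym 1+l≡L) (n≮n L))

    window-path-degree : ∀ {a k} → a + k ≤ L → k + k ≤ ∑⟨ a , suc k ⟩ path-degree
    window-path-degree {a} {zero}  _     = z≤n
    window-path-degree {a} {suc l} a+k≤L = begin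
      suc l + suc l
        ≡⟨ suc-double l ⟩
      1 + (l + l + 1)
        ≤⟨ +-mono-≤ (1≤path-degree a) (+-mono-≤ (≤-reflexive (sym interior)) (1≤path-degree (suc a + l))) ⟩
      path-degree a + (∑⟨ suc a , l ⟩ path-degree + path-degree (suc a + l))
        ≡⟨ cong (path-degree a +_) (sym (∑⟨⟩-snoc path-degree (suc a) l)) ⟩
      ∑⟨ a , suc (suc l) ⟩ path-degree
        ∎
      where
      open ≤-Reasoning
      interior : ∑⟨ suc a , l ⟩ path-degree ≡ l + l
      interior = ∑-path-degree-interior (suc a) l (s≤s z≤n) (subst (_≤ L) (+-suc a l) a+k≤L)

    share : (Fin n → ℕ) → Fin n → ℕ → ℕ
    share f v j = when ((0 <? f v) ×-dec (reach v j ≤? f v)) (path-degree j)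

    share-hears : ∀ {f v j} → j ≤ L → 0 < share f v j → Hears G f (path j) v
    share-hears {f} {v} {j} j≤L 0<share with when-witness ((0 <? f v) ×-dec (reach v j ≤? f v)) 0<share
    ... | 0<fv , reach≤fv = 0<fv , reach v j , reach≤fv , walk-reach v j≤L

    column : ∀ {f} → Packing G f → ∀ {j} → j ≤ L → ∑ (λ v → share f v j) ≤ path-degree j
    column {f} (_ , unique) {j} j≤L = ∑-≤-unique-support
      (λ x y 0<sx 0<sy → unique _ x y (share-hears {f} {x} j≤L 0<sx) (share-hears {f} {y} j≤L 0<sy))
      (λ v → when-≤ ((0 <? f v) ×-dec (reach v j ≤? f v)))

    window-share : ∀ {f v a l} → 0 < f v → a + l ≤ L → (∀ j → a ≤ j → j ≤ a + l → reach v j ≤ f v) →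
                   ∑⟨ a , suc l ⟩ path-degree ≤ ∑⟨ 0 , suc L ⟩ (share f v)
    window-share {f} {v} {a} {l} 0<fv a+l≤L in-reach = ≤-trans
      (∑⟨⟩-mono-≤ a (suc l) λ j a≤j j<a+1+l → ≤-reflexive (sym (when-yes ((0 <? f v) ×-dec (reach v j ≤? f v))
        (0<fv , in-reach j a≤j (≤-pred (subst (j <_) (+-suc a l) j<a+1+l))))))
      (∑⟨⟩-window-≤ (share f v) (subst (_≤ suc L) (sym (+-suc a l)) (s≤s a+l≤L)))

    pendant-share : ∀ {f v} → height v ≡ 1 → f v ≡ 1 → 2 ≤ ∑⟨ 0 , suc L ⟩ (share f v)
    pendant-share {f} {v} t≡1 k≡1 =
      ≤-trans two≤ (window-share {f} {v} {i} {0} (≤-reflexive (sym k≡1)) i+0≤L in-reach)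
      where
      i = proj v
      i+0≤L : i + 0 ≤ L
      i+0≤L = subst (_≤ L) (sym (+-identityʳ i)) (proj≤L v)
      two≤ : 2 ≤ ∑⟨ i , 1 ⟩ path-degree
      two≤ = ≤-reflexive (sym (trans (+-identityʳ _) (path-degree-interior
               (subst (_≤ i) t≡1 (height≤proj v)) (subst (λ t → t + i ≤ L) t≡1 (height+proj≤L v)))))
      in-reach : ∀ j → i ≤ j → j ≤ i + 0 → reach v j ≤ f v
      in-reach j i≤j j≤i+0 = ≤-reflexive (trans
        (cong₂ _+_ t≡1 (m≡n⇒∣m-n∣≡0 (≤-antisym i≤j (subst (j ≤_) (+-identityʳ i) j≤i+0)))) (sym k≡1))

    row : ∀ {f} → Broadcast G f → ∀ v → f v + f v ≤ ∑⟨ 0 , suc L ⟩ (share f v)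
    row {f} bf v with m≤n⇒m<n∨m≡n (z≤n {f v})
    ... | inj₂ 0≡fv rewrite sym 0≡fv = z≤n
    ... | inj₁ 0<fv with height v + height v ≤? f v
    ...   | no 2t≰k with 2t≰k⇒t≡1∧k≡1 (height≤1 v) 0<fv 2t≰k
    ...     | t≡1 , k≡1 =
      subst (λ k → k + k ≤ ∑⟨ 0 , suc L ⟩ (share f v)) (sym k≡1) (pendant-share {f} {v} t≡1 k≡1)
    row {f} bf v | inj₁ 0<fv | yes 2t≤k
      with window-exists 2t≤k (height≤proj v) (height+proj≤L v) (broadcast-bound bf v)
    ... | a , a+k≤L , a+t≤i , t+i≤a+k = ≤-trans (window-path-degree {a} {f v} a+k≤L)
      (window-share {f} {v} {a} {f v} 0<fv a+k≤L λ j a≤j j≤a+k →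
        in-window {height v} {proj v} a+t≤i t+i≤a+k a≤j j≤a+k)

    packing-weight≤L : ∀ {f} → Packing G f → weight G f ≤ L
    packing-weight≤L {f} packing@(bf , _) = m+m≤n+n⇒m≤n (begin
      weight G f + weight G f                       ≡⟨ cong₂ _+_ (weight≡∑ G f) (weight≡∑ G f) ⟩
      ∑ f + ∑ f                                     ≡⟨ sym (∑-distrib-+ f f) ⟩
      ∑ (λ v → f v + f v)                           ≤⟨ ∑-mono-≤ (row bf) ⟩
      ∑ (λ v → ∑⟨ 0 , suc L ⟩ (share f v))          ≡⟨ ∑-∑⟨⟩-swap (share f) 0 (suc L) ⟩
      ∑⟨ 0 , suc L ⟩ (λ j → ∑ (λ v → share f v j))  ≤⟨ ∑⟨⟩-mono-≤ 0 (suc L) (λ j _ → column packing ∘ ≤-pred) ⟩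
      ∑⟨ 0 , suc L ⟩ path-degree                    ≡⟨ ∑-path-degree ⟩
      L + L                                         ∎)
      where open ≤-Reasoning

    L≤diam : ∀ {D} → Diam G D → L ≤ D
    L≤diam (within , _) with within (path 0) (path L)
    ... | j , j≤D , p =
      ≤-trans (subst₂ (λ a b → ∣ a - b ∣ ≤ j) (proj-path 0 z≤n) (proj-path L ≤-refl) (proj-walk p)) j≤D

module _ {n : ℕ} (G : Graph n) where

  module Spine {m : ℕ} (p : Fin m → Fin n) (nonleaf⇔spine : ∀ v → (¬ Leaf G v) ⇔ (∃[ i ] p i ≡ v)) where

    OnSpine : Fin n → Set
    OnSpine v = ∃[ i ] p i ≡ v

    on-spine? : ∀ v → Dec (OnSpine v)
    on-spine? v = any? λ i → p i ≟ v

    spine-nonleaf : ∀ i → ¬ Leaf G (p i)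
    spine-nonleaf i = Equivalence.from (nonleaf⇔spine (p i)) (i , refl)

    -- Off the spine a vertex is a leaf only up to double negation; decidable equality of
    -- vertices is what recovers the uniqueness of its neighbour.
    off-spine-neighbour-unique : ∀ {v u} → ¬ OnSpine v → Adj G v u → ∀ z → Adj G v z → z ≡ u
    off-spine-neighbour-unique {v} {u} off adj z adj′ with z ≟ u
    ... | yes z≡u = z≡u
    ... | no  z≢u = ⊥-elim (off (Equivalence.to (nonleaf⇔spine v)
                      λ (_ , _ , unique) → z≢u (trans (unique z adj′) (sym (unique u adj)))))

    off-spine-edge-closed : ∀ {a b} → ¬ OnSpine a → ¬ OnSpine b → Adj G a b →
                            ∀ {s t k} → s ≡ a ⊎ s ≡ b → Walk G s t k → t ≡ a ⊎ t ≡ b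
    off-spine-edge-closed _ _ _ s∈ab here = s∈ab
    off-spine-edge-closed off-a off-b ab (inj₁ refl) (step adj walk) =
      off-spine-edge-closed off-a off-b ab (inj₂ (off-spine-neighbour-unique off-a ab _ adj)) walk
    off-spine-edge-closed off-a off-b ab (inj₂ refl) (step adj walk) =
      off-spine-edge-closed off-a off-b ab (inj₁ (off-spine-neighbour-unique off-b (Adj-sym G ab) _ adj)) walk

    spine-neighbour : ∀ {w t k} → ¬ OnSpine w → OnSpine t → Walk G w t k → ∃[ i ] Adj G w (p i)
    spine-neighbour off t-on here = ⊥-elim (off t-on)
    spine-neighbour {w} off t-on (step {v = x} adj walk) with on-spine? x
    ... | yes (i , pi≡x) = i , subst (Adj G w) (sym pi≡x) adj
    ... | no off-x with off-spine-edge-closed off off-x adj (inj₂ refl) walk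
    ...   | inj₁ refl = ⊥-elim (off t-on)
    ...   | inj₂ refl = ⊥-elim (off-x t-on)

  module LongSpine (connected : Connected G) {m : ℕ} (p : Fin (suc m) → Fin n)
    (p-injective : Injective _≡_ _≡_ p)
    (nonleaf⇔spine : ∀ v → (¬ Leaf G v) ⇔ (∃[ i ] p i ≡ v))
    (adj⇔consecutive : ∀ i j → Adj G (p i) (p j) ⇔ (suc (toℕ i) ≡ toℕ j ⊎ suc (toℕ j) ≡ toℕ i)) where

    open Spine p nonleaf⇔spine public

    anchor-of : ∀ {w} → ¬ OnSpine w → ∃[ i ] Adj G w (p i)
    anchor-of {w} off = spine-neighbour off (zero , refl) (proj₂ (connected w (p zero)))

    anchor : ∀ {w} → ¬ OnSpine w → Fin (suc m)
    anchor off = proj₁ (anchor-of off)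

    anchor-adj : ∀ {w} (off : ¬ OnSpine w) → Adj G w (p (anchor off))
    anchor-adj off = proj₂ (anchor-of off)

    anchor-unique : ∀ {w z} (off : ¬ OnSpine w) → Adj G w z → z ≡ p (anchor off)
    anchor-unique off adj = off-spine-neighbour-unique off (anchor-adj off) _ adj

    anchor-index : ∀ {w i} (off : ¬ OnSpine w) → Adj G w (p i) → anchor off ≡ i
    anchor-index off adj = p-injective (sym (anchor-unique off adj))

    off-spine-nonadjacent : ∀ {u v} → ¬ OnSpine u → ¬ OnSpine v → ¬ Adj G u v
    off-spine-nonadjacent off-u off-v adj = off-v (anchor off-u , sym (anchor-unique off-u adj))

    adj-spine? : ∀ i z → Dec (Adj G (p i) z)
    adj-spine? i z with on-spine? z
    ... | yes (j , refl) = map′ (Equivalence.from (adj⇔consecutive i j)) (Equivalence.to (adj⇔consecutive i j))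
                             ((suc (toℕ i) ≟ℕ toℕ j) ⊎-dec (suc (toℕ j) ≟ℕ toℕ i))
    ... | no off with i ≟ anchor off
    ...   | yes refl = yes (Adj-sym G (anchor-adj off))
    ...   | no  i≢a  = no λ adj → i≢a (sym (anchor-index off (Adj-sym G adj)))

    other-neighbour : ∀ i {u} → Adj G (p i) u → ∃[ z ] (Adj G (p i) z × z ≢ u)
    other-neighbour i {u} adj with any? (λ z → adj-spine? i z ×-dec ¬? (z ≟ u))
    ... | yes found = found
    ... | no  none  = ⊥-elim (spine-nonleaf i (u , adj , λ z adj′ →
                        decidable-stable (z ≟ u) λ z≢u → none (z , adj′ , z≢u)))

    pendant-neighbour : ∀ i {u} → Adj G (p i) u → (∀ j → Adj G (p i) (p j) → p j ≡ u) →
                        ∃[ z ] (Adj G (p i) z × z ≢ u × ¬ OnSpine z)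
    pendant-neighbour i adj only-u with other-neighbour i adj
    ... | z , adj-z , z≢u = z , adj-z , z≢u ,
          λ (j , pj≡z) → z≢u (trans (sym pj≡z) (only-u j (subst (Adj G (p i)) (sym pj≡z) adj-z)))

    record Ends : Set where
      field
        first last : Fin n
        first-off  : ¬ OnSpine first
        last-off   : ¬ OnSpine last
        first-adj  : Adj G first (p zero)
        last-adj   : Adj G last (p (fromℕ m))
        first≢last : first ≢ last

    module _ (ends : Ends) where
      open Ends ends

      L : ℕ
      L = suc (suc m)

      path : ℕ → Fin n
      path zero = first
      path (suc j) with j <? suc m
      ... | yes j<1+m = p (fromℕ< j<1+m)
      ... | no  _     = last

      path-suc : ∀ {j} (j<1+m : j < suc m) → path (suc j) ≡ p (fromℕ< j<1+m)
      path-suc {j} j<1+m with j <? suc m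
      ... | yes _      = refl
      ... | no  j≮1+m  = ⊥-elim (j≮1+m j<1+m)

      path-spine : ∀ i → path (suc (toℕ i)) ≡ p i
      path-spine i = trans (path-suc (toℕ<n i)) (cong p (fromℕ<-toℕ i (toℕ<n i)))

      path-last : path L ≡ last
      path-last with suc m <? suc m
      ... | yes 1+m<1+m = ⊥-elim (n≮n _ 1+m<1+m)
      ... | no  _       = refl

      path-adj : ∀ i → i < L → Adj G (path i) (path (suc i))
      path-adj zero    _           = subst (Adj G first) (sym (path-spine zero)) first-adj
      path-adj (suc j) (s≤s j<1+m) with suc j <? suc m
      ... | yes 1+j<1+m = subst (λ x → Adj G x _) (sym (path-suc j<1+m))
            (Equivalence.from (adj⇔consecutive _ _)
              (inj₁ (trans (cong suc (toℕ-fromℕ< j<1+m)) (sym (toℕ-fromℕ< 1+j<1+m)))))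
      ... | no  1+j≮1+m = subst (λ x → Adj G x last) (sym (trans (path-suc j<1+m) (cong p fromℕ<≡fromℕ)))
            (Adj-sym G last-adj)
        where
        fromℕ<≡fromℕ : fromℕ< j<1+m ≡ fromℕ m
        fromℕ<≡fromℕ = toℕ-injective (trans (toℕ-fromℕ< j<1+m)
          (trans (≤-antisym (≤-pred j<1+m) (≤-pred (≮⇒≥ 1+j≮1+m))) (sym (toℕ-fromℕ m))))

      data Role (w : Fin n) : Set where
        spine     : ∀ i → p i ≡ w → Role w
        first-end : w ≡ first → Role w
        last-end  : w ≡ last → Role w
        hanging   : (off : ¬ OnSpine w) → w ≢ first → w ≢ last → Role w

      role : ∀ w → Role w
      role w with on-spine? w
      ... | yes (i , pi≡w) = spine i pi≡w
      ... | no  off with w ≟ first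
      ...   | yes w≡first = first-end w≡first
      ...   | no  w≢first with w ≟ last
      ...     | yes w≡last = last-end w≡last
      ...     | no  w≢last = hanging off w≢first w≢last

      position : ∀ {w} → Role w → ℕ
      position (spine i _)       = suc (toℕ i)
      position (first-end _)     = 0
      position (last-end _)      = L
      position (hanging off _ _) = suc (toℕ (anchor off))

      proj : Fin n → ℕ
      proj w = position (role w)

      position-spine : ∀ {i} (c : Role (p i)) → position c ≡ suc (toℕ i)
      position-spine     (spine j pj≡pi)      = cong (suc ∘ toℕ) (p-injective pj≡pi)
      position-spine {i} (first-end pi≡first) = ⊥-elim (first-off (i , pi≡first))
      position-spine {i} (last-end pi≡last)   = ⊥-elim (last-off (i , pi≡last))
      position-spine {i} (hanging off _ _)    = ⊥-elim (off (i , refl))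

      position-first : (c : Role first) → position c ≡ 0
      position-first (spine i pi≡first)   = ⊥-elim (first-off (i , pi≡first))
      position-first (first-end _)        = refl
      position-first (last-end first≡last) = ⊥-elim (first≢last first≡last)
      position-first (hanging _ first≢first _) = ⊥-elim (first≢first refl)

      position-last : (c : Role last) → position c ≡ L
      position-last (spine i pi≡last)    = ⊥-elim (last-off (i , pi≡last))
      position-last (first-end last≡first) = ⊥-elim (first≢last (sym last≡first))
      position-last (last-end _)         = refl
      position-last (hanging _ _ last≢last) = ⊥-elim (last≢last refl)

      position≤L : ∀ {w} (c : Role w) → position c ≤ L
      position≤L (spine i _)       = m≤n⇒m≤1+n (toℕ<n i)
      position≤L (first-end _)     = z≤n
      position≤L (last-end _)      = ≤-refl
      position≤L (hanging off _ _) = m≤n⇒m≤1+n (toℕ<n (anchor off))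

      proj-path : ∀ i → i ≤ L → proj (path i) ≡ i
      proj-path zero    _      = position-first (role first)
      proj-path (suc j) 1+j≤L with j <? suc m
      ... | yes j<1+m = trans (position-spine (role _)) (cong suc (toℕ-fromℕ< j<1+m))
      ... | no  j≮1+m = trans (position-last (role last)) (≤-antisym (s≤s (≮⇒≥ j≮1+m)) 1+j≤L)

      position-adj : ∀ {u v} (cu : Role u) (cv : Role v) → Adj G u v → position cu ≤ suc (position cv)
      position-adj (first-end _) _ _ = z≤n
      position-adj (spine i refl) (spine j refl) adj with Equivalence.to (adj⇔consecutive i j) adj
      ... | inj₁ 1+i≡j = ≤-trans (≤-reflexive 1+i≡j) (m≤n⇒m≤1+n (n≤1+n _))
      ... | inj₂ 1+j≡i = ≤-reflexive (cong suc (sym 1+j≡i))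
      position-adj (spine i refl) (first-end refl) adj
        with p-injective (off-spine-neighbour-unique first-off first-adj (p i) (Adj-sym G adj))
      ... | refl = ≤-refl
      position-adj (spine i refl) (last-end _) _ = m≤n⇒m≤1+n (m≤n⇒m≤1+n (toℕ<n i))
      position-adj (spine i refl) (hanging off _ _) adj rewrite anchor-index off (Adj-sym G adj) = n≤1+n _
      position-adj (last-end refl) (spine j refl) adj
        with p-injective (off-spine-neighbour-unique last-off last-adj (p j) adj)
      ... | refl = s≤s (s≤s (≤-reflexive (sym (toℕ-fromℕ m))))
      position-adj (hanging off _ _) (spine j refl) adj rewrite anchor-index off adj = n≤1+n _
      position-adj (last-end refl) (first-end refl) adj = ⊥-elim (off-spine-nonadjacent last-off first-off adj)
      position-adj (last-end refl) (last-end refl) adj = ⊥-elim (irrefl G adj)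
      position-adj (last-end refl) (hanging off _ _) adj = ⊥-elim (off-spine-nonadjacent last-off off adj)
      position-adj (hanging off _ _) (first-end refl) adj = ⊥-elim (off-spine-nonadjacent off first-off adj)
      position-adj (hanging off _ _) (last-end refl) adj = ⊥-elim (off-spine-nonadjacent off last-off adj)
      position-adj (hanging off _ _) (hanging off′ _ _) adj = ⊥-elim (off-spine-nonadjacent off off′ adj)

      attachment-of : ∀ {w} (c : Role w) → Attachment G path L w (position c)
      attachment-of (spine i refl)   = on-path (path-spine i)
      attachment-of (first-end refl) = on-path refl
      attachment-of (last-end refl)  = on-path path-last
      attachment-of {w} (hanging off _ _) =
        pendant (subst (Adj G w) (sym (path-spine a)) (anchor-adj off))
                (λ z adj → trans (anchor-unique off adj) (sym (path-spine a)))
                (s≤s z≤n) (s≤s (toℕ<n a))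
        where a = anchor off

      frame : Frame G
      frame = record
        { L = L ; 1≤L = s≤s z≤n ; path = path ; path-adj = path-adj
        ; proj = proj ; proj≤L = λ w → position≤L (role w) ; proj-path = proj-path
        ; proj-adj = λ {u} {v} → position-adj (role u) (role v)
        ; attachment = λ w → attachment-of (role w)
        }

  spine-ends : (connected : Connected G) {m : ℕ} (p : Fin (suc m) → Fin n)
    (p-injective : Injective _≡_ _≡_ p)
    (nonleaf⇔spine : ∀ v → (¬ Leaf G v) ⇔ (∃[ i ] p i ≡ v))
    (adj⇔consecutive : ∀ i j → Adj G (p i) (p j) ⇔ (suc (toℕ i) ≡ toℕ j ⊎ suc (toℕ j) ≡ toℕ i)) →
    ∀ {a b : Fin n} → a ≢ b → LongSpine.Ends connected p p-injective nonleaf⇔spine adj⇔consecutive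
  spine-ends connected {zero} p p-injective nonleaf⇔spine adj⇔consecutive {a} {b} a≢b = record
    { first = w ; last = z ; first-off = w-off ; last-off = z-off
    ; first-adj = w-adj ; last-adj = Adj-sym G p0~z ; first≢last = λ w≡z → z≢w (sym w≡z) }
    where
    open LongSpine connected p p-injective nonleaf⇔spine adj⇔consecutive
    other : ∃[ w ] p zero ≢ w
    other with a ≟ p zero
    ... | yes a≡p0 = b , λ p0≡b → a≢b (trans a≡p0 p0≡b)
    ... | no  a≢p0 = a , λ p0≡a → a≢p0 (sym p0≡a)
    w = proj₁ other
    w-off : ¬ OnSpine w
    w-off (zero , p0≡w) = proj₂ other p0≡w
    w-adj : Adj G w (p zero)
    w-adj with anchor-of w-off
    ... | zero , adj = adj
    z-found = pendant-neighbour zero (Adj-sym G w-adj) λ { zero adj → ⊥-elim (irrefl G adj) }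
    z = proj₁ z-found
    p0~z = proj₁ (proj₂ z-found)
    z≢w = proj₁ (proj₂ (proj₂ z-found))
    z-off = proj₂ (proj₂ (proj₂ z-found))
  spine-ends connected {suc k} p p-injective nonleaf⇔spine adj⇔consecutive _ = record
    { first = proj₁ first-found ; last = proj₁ last-found
    ; first-off = proj₂ (proj₂ (proj₂ first-found)) ; last-off = proj₂ (proj₂ (proj₂ last-found))
    ; first-adj = Adj-sym G (proj₁ (proj₂ first-found)) ; last-adj = Adj-sym G (proj₁ (proj₂ last-found))
    ; first≢last = first≢last }
    where
    open LongSpine connected p p-injective nonleaf⇔spine adj⇔consecutive
    last-index prev-index : Fin (suc (suc k))
    last-index = fromℕ (suc k)
    prev-index = inject₁ (fromℕ k)
    toℕ-prev : toℕ prev-index ≡ k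
    toℕ-prev = trans (toℕ-inject₁ (fromℕ k)) (toℕ-fromℕ k)
    consecutive : ∀ {i j} → suc (toℕ i) ≡ toℕ j → Adj G (p i) (p j)
    consecutive = Equivalence.from (adj⇔consecutive _ _) ∘ inj₁
    only-second : ∀ j → Adj G (p zero) (p j) → p j ≡ p (suc zero)
    only-second j adj with Equivalence.to (adj⇔consecutive zero j) adj
    ... | inj₁ 1≡j = cong p (toℕ-injective (sym 1≡j))
    only-prev : ∀ j → Adj G (p last-index) (p j) → p j ≡ p prev-index
    only-prev j adj with Equivalence.to (adj⇔consecutive last-index j) adj
    ... | inj₁ 1+last≡j = ⊥-elim (n≮n (suc (suc k))
            (subst (_< suc (suc k)) (trans (sym 1+last≡j) (cong suc (toℕ-fromℕ (suc k)))) (toℕ<n j)))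
    ... | inj₂ 1+j≡last = cong p (toℕ-injective (trans (suc-injective (trans 1+j≡last (toℕ-fromℕ (suc k))))
                                                      (sym toℕ-prev)))
    first-found = pendant-neighbour zero (consecutive refl) only-second
    last-found  = pendant-neighbour last-index
                    (Adj-sym G (consecutive (trans (cong suc toℕ-prev) (sym (toℕ-fromℕ (suc k)))))) only-prev
    first≢last : proj₁ first-found ≢ proj₁ last-found
    first≢last first≡last with p-injective (off-spine-neighbour-unique (proj₂ (proj₂ (proj₂ first-found)))
      (Adj-sym G (proj₁ (proj₂ first-found))) (p last-index)
      (subst (λ x → Adj G x (p last-index)) (sym first≡last) (Adj-sym G (proj₁ (proj₂ last-found)))))
    ... | ()

  module NoSpine (connected : Connected G) (p : Fin 0 → Fin n)
    (nonleaf⇔spine : ∀ v → (¬ Leaf G v) ⇔ (∃[ i ] p i ≡ v)) {a b : Fin n} (a≢b : a ≢ b) where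

    open Spine p nonleaf⇔spine

    off : ∀ v → ¬ OnSpine v
    off v (() , _)

    first-step : ∀ {k} → Walk G a b k → ∃[ c ] Adj G a c
    first-step here           = ⊥-elim (a≢b refl)
    first-step (step adj _) = _ , adj

    c : Fin n
    c = proj₁ (first-step (proj₂ (connected a b)))

    a~c : Adj G a c
    a~c = proj₂ (first-step (proj₂ (connected a b)))

    every-vertex : ∀ z → z ≡ a ⊎ z ≡ c
    every-vertex z = off-spine-edge-closed (off a) (off c) a~c (inj₁ refl) (proj₂ (connected a z))

    path : ℕ → Fin n
    path zero    = a
    path (suc _) = c

    proj : Fin n → ℕ
    proj z = when (¬? (z ≟ a)) 1

    proj-a : proj a ≡ 0
    proj-a = when-no (¬? (a ≟ a)) λ a≢a → a≢a refl

    proj-c : proj c ≡ 1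
    proj-c = when-yes (¬? (c ≟ a)) λ c≡a → irrefl G (subst (Adj G a) c≡a a~c)

    proj-path : ∀ i → i ≤ 1 → proj (path i) ≡ i
    proj-path zero          _ = proj-a
    proj-path (suc zero)    _ = proj-c
    proj-path (suc (suc _)) (s≤s ())

    path-proj : ∀ z → path (proj z) ≡ z
    path-proj z with every-vertex z
    ... | inj₁ refl = cong path proj-a
    ... | inj₂ refl = cong path proj-c

    frame : Frame G
    frame = record
      { L = 1 ; 1≤L = ≤-refl ; path = path ; path-adj = λ { zero _ → a~c ; (suc _) (s≤s ()) }
      ; proj = proj ; proj≤L = λ z → when-≤ (¬? (z ≟ a)) ; proj-path = proj-path
      ; proj-adj = λ {u} _ → ≤-trans (when-≤ (¬? (u ≟ a))) (s≤s z≤n)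
      ; attachment = λ z → on-path (path-proj z)
      }

  caterpillar-frame : Connected G → ∀ {m} (p : Fin m → Fin n) → Injective _≡_ _≡_ p →
    (∀ v → (¬ Leaf G v) ⇔ (∃[ i ] p i ≡ v)) →
    (∀ i j → Adj G (p i) (p j) ⇔ (suc (toℕ i) ≡ toℕ j ⊎ suc (toℕ j) ≡ toℕ i)) →
    ∀ {a b : Fin n} → a ≢ b → Frame G
  caterpillar-frame connected {zero} p _ nonleaf⇔spine _ a≢b = NoSpine.frame connected p nonleaf⇔spine a≢b
  caterpillar-frame connected {suc m} p p-injective nonleaf⇔spine adj⇔consecutive a≢b =
    LongSpine.frame connected p p-injective nonleaf⇔spine adj⇔consecutive
      (spine-ends connected p p-injective nonleaf⇔spine adj⇔consecutive a≢b)

mainTheorem6 : ∀ (n : ℕ) → 2 ≤ n → (T : Graph n) → Caterpillar T →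
    ∀ D → Diam T D → PackingBroadcastNumber T D
mainTheorem6 (suc (suc n)) _ T ((connected , _) , _ , p , p-injective , nonleaf⇔spine , adj⇔consecutive) D diam
  = diametral-packing T diam
  , λ _ packing → ≤-trans (packing-weight≤L packing) (L≤diam diam)
  where
  frame : Frame T
  frame = caterpillar-frame T connected p p-injective nonleaf⇔spine adj⇔consecutive {zero} {suc zero} λ ()
  open FrameProperties T frame
mainTheorem6 (suc zero) (s≤s ())
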